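{- Let $\ell \ge 1$ and let $A$ be a near-modular set with respect to $3^{\ell}$ with $|A| = 2^{\ell}$. Let $(b_k)_{k \ge 0}$ be a sequence of positive integers such that for every $k$, $3^{k+\ell}$ is the largest power of $3$ dividing $b_k$, and $b_k = 3^{k+\ell}$ for all sufficiently large $k$. Then the set \[\Big\{a + \sum_{k=0}^{\infty} \delta_k b_k \;:\; a \in A,\ \delta_k \in \{0,1\},\ \sum_{k=0}^{\infty} \delta_k < \infty\Big\}\] is the set of elements of an independent Stanley sequence.
   Context: A near-modular set with respect to a positive integer $N$ is a set $A$ of nonnegative integers such that: $0 \in A$; whenever $x, y, z \in A$ satisfy $x \equiv 2y - z \pmod N$, then $x = y = z$; and for every integer $x$ there exist $y, z \in A$ with $y \ge z$ and $x \equiv 2y - z \pmod N$ (elements of $A$ may exceed $N$). A set of integers is 3-free if it contains no nontrivial 3-term arithmetic progression. For a finite 3-free set $A$ of nonnegative integers containing $0$, the Stanley sequence $S(A)$ is the increasing sequence obtained by listing $A$ in increasing order and then repeatedly appending the least integer larger than the current last term keeping the set 3-free; its terms are written $a_0 = 0 < a_1 < a_2 < \cdots$. A Stanley sequence $(a_n)$ is independent if there exist constants $\lambda$ and $\chi$ such that for all $k \ge \chi$ and $0 \le i < 2^k$: $a_{2^k+i} = a_{2^k} + a_i$ and $a_{2^k} = 2a_{2^k-1} - \lambda + 1$. -}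

module Defs where

open import Data.Nat as ℕ using (ℕ; zero; suc; _+_; _*_; _^_; _≤_; _<_; _≥_)
open import Data.Nat.Divisibility as ℕD using ()
open import Data.Integer as ℤ using (ℤ; +_)
open import Data.Integer.Divisibility as ℤD using ()
open import Data.List using (List; []; _∷_; length)
open import Data.List.Membership.Propositional using (_∈_)
open import Data.List.Relation.Unary.Unique.Propositional using (Unique)
open import Data.Bool using (Bool; true; false)
open import Data.Product using (Σ; ∃; ∃-syntax; _×_; _,_)
open import Data.Sum using (_⊎_)
open import Relation.Nullary using (¬_)
open import Relation.Binary.PropositionalEquality using (_≡_)

CongAP : ℕ → ℤ → ℤ → ℤ → Set
CongAP N x y z = (+ N) ℤD.∣ (x ℤ.- ((+ 2) ℤ.* y ℤ.- z))

NearModular : ℕ → List ℕ → Set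
NearModular N A =
  (0 ∈ A)
  × (∀ x y z → x ∈ A → y ∈ A → z ∈ A →
       CongAP N (+ x) (+ y) (+ z) → (x ≡ y × y ≡ z))
  × (∀ (x : ℤ) → ∃[ y ] ∃[ z ] (y ∈ A × z ∈ A × z ≤ y × CongAP N x (+ y) (+ z)))

-- no x < y < z with x + z = 2y (equivalently x + z = 2y forces x = y = z)
ThreeFree : (ℕ → Set) → Set
ThreeFree P = ∀ x y z → P x → P y → P z → x + z ≡ 2 * y → x ≡ y

Prefix : (ℕ → ℕ) → ℕ → ℕ → Set
Prefix a n x = ∃[ i ] (i ≤ n × a i ≡ x)

-- a is the Stanley sequence S(A₀) where A₀ = {a 0, …, a (m-1)} (m ≥ 1):
-- a starts with 0, is strictly increasing, A₀ is 3-free, and every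
-- later term a (suc j) (with suc j ≥ m) is the least integer > a j
-- keeping {a 0, …, a (suc j)} 3-free.
IsStanleyFrom : ℕ → (ℕ → ℕ) → Set
IsStanleyFrom m a =
  (1 ≤ m)
  × (a 0 ≡ 0)
  × (∀ n → a n < a (suc n))
  × ThreeFree (λ x → ∃[ i ] (i < m × a i ≡ x))
  × (∀ j → m ≤ suc j →
       ThreeFree (Prefix a (suc j))
       × (∀ c → a j < c → c < a (suc j) →
            ¬ ThreeFree (λ x → Prefix a j x ⊎ x ≡ c)))

StanleySequence : (ℕ → ℕ) → Set
StanleySequence a = ∃[ m ] IsStanleyFrom m a

Independent : (ℕ → ℕ) → Set
Independent a =
  ∃[ λ' ] ∃[ χ ] (∀ k → χ ≤ k →
     (∀ i → i < 2 ^ k → a (2 ^ k + i) ≡ a (2 ^ k) + a i)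
     × (+ a (2 ^ k) ≡ (+ 2) ℤ.* (+ a (2 ^ k ℕ.∸ 1)) ℤ.- λ' ℤ.+ (+ 1)))

-- Σ_{i} δ_i b_{k+i} for a finite 0/1 list δ (finite support)
subsetSumFrom : (ℕ → ℕ) → ℕ → List Bool → ℕ
subsetSumFrom b k [] = 0
subsetSumFrom b k (true ∷ ds) = b k + subsetSumFrom b (suc k) ds
subsetSumFrom b k (false ∷ ds) = subsetSumFrom b (suc k) ds

GenSet : List ℕ → (ℕ → ℕ) → ℕ → Set
GenSet A b x = ∃[ a ] ∃[ δ ] (a ∈ A × x ≡ a + subsetSumFrom b 0 δ)

ExactPow3 : ℕ → ℕ → Set
ExactPow3 e n = (3 ^ e) ℕD.∣ n × ¬ ((3 ^ suc e) ℕD.∣ n)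

module Submission where

-- If T is near-modular mod N and 3 ∤ u, then T ∪ (uN + T) is near-modular mod 3N: an AP
-- mod 3N reduces to one in T, and the 0/1 shift coefficients are then pinned down mod 3.
-- So level k = A + {subset sums of b₀, …, bₖ₋₁} is near-modular mod 3^{k+ℓ}, with 2^{k+ℓ}
-- elements. Once bₖ = 3^{k+ℓ} and K is large, level K lies below P = 3^{K+ℓ} and the
-- generated set is level K + P·{numbers with ternary digits 0, 1}. Its increasing
-- enumeration is s(i + mQ) = tᵢ + P·asTernary m, where t enumerates level K, Q = |level K|
-- and asTernary m reads the binary digits of m in base 3; this shape gives independence.
-- A 3-AP among terms is an AP mod P in level K, hence constant there, leaving a 3-AP of
-- 0/1-digit ternary numbers, which is trivial because digits cannot carry. Greediness: for
-- c between consecutive terms, the covering property mod P gives y, z ∈ level K with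
-- c + z ≡ 2y, and splitting (c + z − 2y)/P as 2·(0/1-ternary) − (0/1-ternary) lifts y, z
-- to terms completing c to a 3-AP.

open import Data.Bool using (Bool; true; false)
open import Data.Empty using (⊥-elim)
open import Data.Integer as ℤ using (ℤ; _⊖_; ∣_∣) renaming (+_ to pos)
import Data.Integer.Properties as ℤ
import Data.Integer.Tactic.RingSolver as ℤ-Solver
open import Data.List using (List; []; _∷_; length; _++_; map)
open import Data.List.Extrema.Nat using (max; xs≤max)
open import Data.List.Membership.Propositional using (_∈_)
open import Data.List.Membership.Propositional.Properties using (∈-++⁺ˡ; ∈-++⁺ʳ; ∈-++⁻; ∈-map⁺; ∈-map⁻)
open import Data.List.Properties using (length-++; length-map)
open import Data.List.Relation.Binary.Permutation.Propositional using (_↭_; ↭-sym; ↭⇒↭ₛ′)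
open import Data.List.Relation.Binary.Permutation.Propositional.Properties using (↭-length; ∈-resp-↭)
import Data.List.Relation.Binary.Permutation.Setoid.Properties as PermutationSetoid
open import Data.List.Relation.Unary.All as All using (All)
open import Data.List.Relation.Unary.AllPairs as AllPairs using (AllPairs; _∷_)
open import Data.List.Relation.Unary.Any using (here; there)
open import Data.List.Relation.Unary.Linked.Properties using (Linked⇒AllPairs)
open import Data.List.Relation.Unary.Unique.Propositional using (Unique)
import Data.List.Relation.Unary.Unique.Propositional.Properties as Unique
open import Data.Nat using (ℕ; zero; suc; _+_; _*_; _∸_; _^_; _≤_; _<_; _%_; _/_; z≤n; s≤s; NonZero)
open import Data.Nat.DivMod
open import Data.Nat.Divisibility using (_∣_; divides; n∣m*n; ∣m+n∣m⇒∣n)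
open import Data.Nat.Induction using (<-rec)
open import Data.Nat.Properties
open import Data.Nat.Tactic.RingSolver using (solve-∀)
open import Data.List.Sort ≤-decTotalOrder using (sort; sort-↭; sort-↗)
open import Data.Product using (∃-syntax; _,_; proj₁; proj₂; _×_; uncurry)
open import Data.Sum using (_⊎_; inj₁; inj₂)
open import Defs
open import Function.Bundles using (_⇔_; mk⇔)
open import Relation.Binary.Definitions using (tri<; tri≈; tri>)
open import Relation.Binary.PropositionalEquality
open import Relation.Binary.PropositionalEquality.Properties using (isEquivalence)
open import Relation.Nullary using (¬_)

module Permutation = PermutationSetoid (setoid ℕ)

[m+kn]%n≡m : ∀ {m n} k .{{_ : NonZero n}} → m < n → (m + k * n) % n ≡ m
[m+kn]%n≡m {m} {n} k m<n = trans ([m+kn]%n≡m%n m k n) (m<n⇒m%n≡m m<n)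

[m+kn]/n≡k : ∀ {m n} k .{{_ : NonZero n}} → m < n → (m + k * n) / n ≡ k
[m+kn]/n≡k {m} {n} k m<n = begin
  (m + k * n) / n  ≡⟨ +-distrib-/-∣ʳ m (n∣m*n k) ⟩
  m / n + k * n / n ≡⟨ cong₂ _+_ (m<n⇒m/n≡0 m<n) (m*n/n≡m k n) ⟩
  k                ∎
  where open ≡-Reasoning

m+kn≡m′+k′n⇒m≡m′×k≡k′ : ∀ {m m′ k k′} n .{{_ : NonZero n}} → m < n → m′ < n →
                       m + k * n ≡ m′ + k′ * n → m ≡ m′ × k ≡ k′
m+kn≡m′+k′n⇒m≡m′×k≡k′ {k = k} {k′} n m<n m′<n eq =
  trans (sym ([m+kn]%n≡m k m<n)) (trans (cong (_% n) eq) ([m+kn]%n≡m k′ m′<n)) ,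
  trans (sym ([m+kn]/n≡k k m<n)) (trans (cong (_/ n) eq) ([m+kn]/n≡k k′ m′<n))

n<m^n : ∀ {m} → 1 < m → ∀ n → n < m ^ n
n<m^n 1<m zero = s≤s z≤n
n<m^n {m@(suc _)} 1<m (suc n) =
  ≤-<-trans (n<m^n 1<m n) (subst (m ^ n <_) (*-comm (m ^ n) m) (m<m*n (m ^ n) m {{m^n≢0 m n}} 1<m))

%-*-reduceʳ : ∀ m n d .{{_ : NonZero d}} → (m * n) % d ≡ (m * (n % d)) % d
%-*-reduceʳ m n d = begin
  (m * n) % d               ≡⟨ %-distribˡ-* m n d ⟩
  (m % d * (n % d)) % d     ≡⟨ cong (λ v → (m % d * v) % d) (sym (m%n%n≡m%n n d)) ⟩
  (m % d * (n % d % d)) % d ≡⟨ sym (%-distribˡ-* m (n % d) d) ⟩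
  (m * (n % d)) % d         ∎
  where open ≡-Reasoning

%-+-*-reduceʳ : ∀ a m n d .{{_ : NonZero d}} → (a + m * n) % d ≡ (a % d + m * (n % d)) % d
%-+-*-reduceʳ a m n d = begin
  (a + m * n) % d                  ≡⟨ %-distribˡ-+ a (m * n) d ⟩
  (a % d + (m * n) % d) % d        ≡⟨ cong (λ v → (a % d + v) % d) (%-*-reduceʳ m n d) ⟩
  (a % d + (m * (n % d)) % d) % d  ≡⟨ cong (λ v → (v + (m * (n % d)) % d) % d) (sym (m%n%n≡m%n a d)) ⟩
  (a % d % d + (m * (n % d)) % d) % d ≡⟨ sym (%-distribˡ-+ (a % d) (m * (n % d)) d) ⟩
  (a % d + m * (n % d)) % d        ∎
  where open ≡-Reasoning

infix 4 _≡_[mod_]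

_≡_[mod_] : ℕ → ℕ → ℕ → Set
x ≡ y [mod n ] = ∃[ p ] ∃[ q ] x + p * n ≡ y + q * n

≡[mod]-sym : ∀ {x y n} → x ≡ y [mod n ] → y ≡ x [mod n ]
≡[mod]-sym (p , q , eq) = q , p , sym eq

≡[mod]⇒%≡ : ∀ {x y} n .{{_ : NonZero n}} → x ≡ y [mod n ] → x % n ≡ y % n
≡[mod]⇒%≡ {x} {y} n (p , q , eq) =
  trans (sym ([m+kn]%n≡m%n x p n)) (trans (cong (_% n) eq) ([m+kn]%n≡m%n y q n))

%≡⇒≡[mod] : ∀ {x y} n .{{_ : NonZero n}} → x % n ≡ y % n → x ≡ y [mod n ]
%≡⇒≡[mod] {x} {y} n eq = y / n , x / n , (begin
  x + y / n * n               ≡⟨ cong (_+ y / n * n) (m≡m%n+[m/n]*n x n) ⟩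
  x % n + x / n * n + y / n * n ≡⟨ cong (λ r → r + x / n * n + y / n * n) eq ⟩
  y % n + x / n * n + y / n * n ≡⟨ swap (y % n) (x / n * n) (y / n * n) ⟩
  y % n + y / n * n + x / n * n ≡⟨ cong (_+ x / n * n) (sym (m≡m%n+[m/n]*n y n)) ⟩
  y + x / n * n               ∎)
  where
  open ≡-Reasoning
  swap : ∀ a b c → a + b + c ≡ a + c + b
  swap = solve-∀

∸-divisible⇒≡[mod] : ∀ {n u v} → v ≤ u → n ∣ u ∸ v → u ≡ v [mod n ]
∸-divisible⇒≡[mod] {u = u} {v} v≤u (divides k eq) =
  0 , k , trans (+-identityʳ u) (trans (sym (m+[n∸m]≡n v≤u)) (cong (v +_) eq))

≡[mod]⇒∸-divisible : ∀ {n u v} → v ≤ u → u ≡ v [mod n ] → n ∣ u ∸ v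
≡[mod]⇒∸-divisible {n} {u} {v} v≤u (p , q , eq) =
  ∣m+n∣m⇒∣n (subst (n ∣_) (sym difference) (n∣m*n q)) (n∣m*n p)
  where
  open ≡-Reasoning
  shuffle : ∀ a b c → a + (b + c) ≡ a + c + b
  shuffle = solve-∀
  difference : p * n + (u ∸ v) ≡ q * n
  difference = +-cancelˡ-≡ v _ _ (begin
    v + (p * n + (u ∸ v)) ≡⟨ shuffle v (p * n) (u ∸ v) ⟩
    v + (u ∸ v) + p * n   ≡⟨ cong (_+ p * n) (m+[n∸m]≡n v≤u) ⟩
    u + p * n             ≡⟨ eq ⟩
    v + q * n             ∎)

pos-x-[2y-z] : ∀ x y z → pos x ℤ.- (pos 2 ℤ.* pos y ℤ.- pos z) ≡ (x + z) ⊖ (2 * y)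
pos-x-[2y-z] x y z = begin
  pos x ℤ.- (pos 2 ℤ.* pos y ℤ.- pos z)  ≡⟨ regroup (pos x) (pos y) (pos z) ⟩
  (pos x ℤ.+ pos z) ℤ.- pos 2 ℤ.* pos y  ≡⟨ cong₂ ℤ._-_ (sym (ℤ.pos-+ x z)) (sym (ℤ.pos-* 2 y)) ⟩
  pos (x + z) ℤ.- pos (2 * y)            ≡⟨ ℤ.m-n≡m⊖n (x + z) (2 * y) ⟩
  (x + z) ⊖ (2 * y)                      ∎
  where
  open ≡-Reasoning
  regroup : ∀ (a b c : ℤ) → a ℤ.- (pos 2 ℤ.* b ℤ.- c) ≡ (a ℤ.+ c) ℤ.- pos 2 ℤ.* b
  regroup = ℤ-Solver.solve-∀

∣⊖∣≡∸ : ∀ {u v} → v ≤ u → ∣ u ⊖ v ∣ ≡ u ∸ v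
∣⊖∣≡∸ {u} {v} v≤u = trans (ℤ.∣m⊖n∣≡∣n⊖m∣ u v) (ℤ.∣⊖∣-≤ v≤u)

∣⊖∣⇒≡[mod] : ∀ {n} u v → n ∣ ∣ u ⊖ v ∣ → u ≡ v [mod n ]
∣⊖∣⇒≡[mod] {n} u v n∣u⊖v with ≤-total v u
... | inj₁ v≤u = ∸-divisible⇒≡[mod] v≤u (subst (n ∣_) (∣⊖∣≡∸ v≤u) n∣u⊖v)
... | inj₂ u≤v = ≡[mod]-sym (∸-divisible⇒≡[mod] u≤v (subst (n ∣_) (ℤ.∣⊖∣-≤ u≤v) n∣u⊖v))

≡[mod]⇒∣⊖∣ : ∀ {n} u v → u ≡ v [mod n ] → n ∣ ∣ u ⊖ v ∣
≡[mod]⇒∣⊖∣ {n} u v u≡v with ≤-total v u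
... | inj₁ v≤u = subst (n ∣_) (sym (∣⊖∣≡∸ v≤u)) (≡[mod]⇒∸-divisible v≤u u≡v)
... | inj₂ u≤v = subst (n ∣_) (sym (ℤ.∣⊖∣-≤ u≤v)) (≡[mod]⇒∸-divisible u≤v (≡[mod]-sym u≡v))

bit : Bool → ℕ
bit true = 1
bit false = 0

bit<2 : ∀ e → bit e < 2
bit<2 true = s≤s (s≤s z≤n)
bit<2 false = s≤s z≤n

ternary : List Bool → ℕ
ternary [] = 0
ternary (e ∷ δ) = bit e + 3 * ternary δ

headBit : List Bool → Bool
headBit [] = false
headBit (e ∷ _) = e

tailBits : List Bool → List Bool
tailBits [] = []
tailBits (_ ∷ δ) = δ

ternary-headBit-tailBits : ∀ δ → ternary δ ≡ bit (headBit δ) + 3 * ternary (tailBits δ)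
ternary-headBit-tailBits [] = refl
ternary-headBit-tailBits (e ∷ δ) = refl

bit-3AP : ∀ a b c → bit a + bit c ≡ 2 * bit b → a ≡ b × b ≡ c
bit-3AP true true true _ = refl , refl
bit-3AP false false false _ = refl , refl
bit-3AP true true false ()
bit-3AP true false true ()
bit-3AP true false false ()
bit-3AP false true true ()
bit-3AP false true false ()
bit-3AP false false true ()

bit+bit<3 : ∀ a c → bit a + bit c < 3
bit+bit<3 a c = +-mono-≤ (bit<2 a) (≤-pred (bit<2 c))

2*bit<3 : ∀ b → 2 * bit b < 3
2*bit<3 true = s≤s (s≤s (s≤s z≤n))
2*bit<3 false = s≤s z≤n

-- Comparing last ternary digits: 0/1 digits cannot carry.
ternary-3AP-digit : ∀ a b c A B C → bit a + 3 * A + (bit c + 3 * C) ≡ 2 * (bit b + 3 * B) →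
                    (a ≡ b × b ≡ c) × A + C ≡ 2 * B
ternary-3AP-digit a b c A B C eq
  with m+kn≡m′+k′n⇒m≡m′×k≡k′ 3 (bit+bit<3 a c) (2*bit<3 b)
         (trans (sym (split₁ (bit a) (bit c) A C)) (trans eq (split₂ (bit b) B)))
  where
  split₁ : ∀ x y A C → x + 3 * A + (y + 3 * C) ≡ x + y + (A + C) * 3
  split₁ = solve-∀
  split₂ : ∀ x B → 2 * (x + 3 * B) ≡ 2 * x + 2 * B * 3
  split₂ = solve-∀
... | digits , rest = bit-3AP a b c digits , rest

ternary-3free : ∀ a b c → ternary a + ternary c ≡ 2 * ternary b → ternary a ≡ ternary b
ternary-3free a [] c eq = m+n≡0⇒m≡0 (ternary a) eq
ternary-3free a (e ∷ b) c eq
  with ternary-3AP-digit (headBit a) e (headBit c) (ternary (tailBits a)) (ternary b) (ternary (tailBits c))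
         (subst₂ (λ u v → u + v ≡ 2 * ternary (e ∷ b))
           (ternary-headBit-tailBits a) (ternary-headBit-tailBits c) eq)
... | (refl , _) , rest =
  trans (ternary-headBit-tailBits a) (cong (λ v → bit e + 3 * v) (ternary-3free (tailBits a) b (tailBits c) rest))

TernarySplit : ℕ → Set
TernarySplit q = ∃[ δ ] ∃[ δ′ ] (q + ternary δ′ ≡ 2 * ternary δ) × ternary δ′ ≤ ternary δ

digit-split : ∀ r → r < 3 → ∃[ e ] ∃[ e′ ] (r + bit e′ ≡ 2 * bit e) × bit e′ ≤ bit e
digit-split 0 _ = false , false , refl , z≤n
digit-split 1 _ = true , true , refl , s≤s z≤n
digit-split 2 _ = true , false , refl , z≤n
digit-split (suc (suc (suc _))) (s≤s (s≤s (s≤s ())))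

ternary-split : ∀ q → TernarySplit q
ternary-split = <-rec TernarySplit split
  where
  split : ∀ q → (∀ {q′} → q′ < q → TernarySplit q′) → TernarySplit q
  split zero _ = [] , [] , refl , z≤n
  split q@(suc _) rec
    with rec (m/n<m q 3 (s≤s (s≤s z≤n))) | digit-split (q % 3) (m%n<n q 3)
  ... | δ , δ′ , eq , δ′≤δ | e , e′ , eqₑ , e′≤e =
    e ∷ δ , e′ ∷ δ′ ,
    (begin
      q + (bit e′ + 3 * ternary δ′)                        ≡⟨ cong (_+ (bit e′ + 3 * ternary δ′)) (m≡m%n+[m/n]*n q 3) ⟩
      q % 3 + q / 3 * 3 + (bit e′ + 3 * ternary δ′)         ≡⟨ regroup (q % 3) (q / 3) (bit e′) (ternary δ′) ⟩
      q % 3 + bit e′ + 3 * (q / 3 + ternary δ′)            ≡⟨ cong₂ (λ u v → u + 3 * v) eqₑ eq ⟩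
      2 * bit e + 3 * (2 * ternary δ)                     ≡⟨ double (bit e) (ternary δ) ⟩
      2 * (bit e + 3 * ternary δ)                         ∎) ,
    +-mono-≤ e′≤e (*-monoʳ-≤ 3 δ′≤δ)
    where
    open ≡-Reasoning
    regroup : ∀ r q x y → r + q * 3 + (x + 3 * y) ≡ r + x + 3 * (q + y)
    regroup = solve-∀
    double : ∀ x y → 2 * x + 3 * (2 * y) ≡ 2 * (x + 3 * y)
    double = solve-∀

-- asTernary n is the number whose base-3 digits are the binary digits of n;
-- the first argument of asTernary-fuel is a recursion bound, sufficient once ≥ n.
asTernary-fuel : ℕ → ℕ → ℕ
asTernary-fuel zero n = 0
asTernary-fuel (suc f) n = n % 2 + 3 * asTernary-fuel f (n / 2)

asTernary : ℕ → ℕ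
asTernary n = asTernary-fuel n n

asTernary-fuel-0 : ∀ f → asTernary-fuel f 0 ≡ 0
asTernary-fuel-0 zero = refl
asTernary-fuel-0 (suc f) rewrite asTernary-fuel-0 f = refl

n≤1+f⇒n/2≤f : ∀ n f → n ≤ suc f → n / 2 ≤ f
n≤1+f⇒n/2≤f zero f _ = z≤n
n≤1+f⇒n/2≤f (suc n) f n≤1+f = ≤-pred (≤-trans (m/n<m (suc n) 2 (s≤s (s≤s z≤n))) n≤1+f)

asTernary-fuel-irrelevant : ∀ f g n → n ≤ f → n ≤ g → asTernary-fuel f n ≡ asTernary-fuel g n
asTernary-fuel-irrelevant zero g .0 z≤n _ = sym (asTernary-fuel-0 g)
asTernary-fuel-irrelevant (suc f) zero .0 _ z≤n = asTernary-fuel-0 (suc f)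
asTernary-fuel-irrelevant (suc f) (suc g) n n≤f n≤g =
  cong (λ v → n % 2 + 3 * v)
       (asTernary-fuel-irrelevant f g (n / 2) (n≤1+f⇒n/2≤f n f n≤f) (n≤1+f⇒n/2≤f n g n≤g))

asTernary-unfold : ∀ n → asTernary n ≡ n % 2 + 3 * asTernary (n / 2)
asTernary-unfold zero = refl
asTernary-unfold (suc f) =
  cong (λ v → suc f % 2 + 3 * v)
       (asTernary-fuel-irrelevant f (suc f / 2) (suc f / 2) (n≤1+f⇒n/2≤f (suc f) f ≤-refl) ≤-refl)

asTernary-digit : ∀ d m → d < 2 → asTernary (d + m * 2) ≡ d + 3 * asTernary m
asTernary-digit d m d<2 =
  trans (asTernary-unfold (d + m * 2))
        (cong₂ (λ r q → r + 3 * asTernary q) ([m+kn]%n≡m m d<2) ([m+kn]/n≡k m d<2))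

ParityView : ℕ → Set
ParityView m = ∃[ d ] ∃[ m′ ] d < 2 × m ≡ d + m′ * 2

parityView : ∀ m → ParityView m
parityView m = m % 2 , m / 2 , m%n<n m 2 , m≡m%n+[m/n]*n m 2

<2⇒bit : ∀ {d} → d < 2 → ∃[ e ] bit e ≡ d
<2⇒bit {0} _ = false , refl
<2⇒bit {1} _ = true , refl
<2⇒bit {suc (suc _)} (s≤s (s≤s ()))

asTernary-fuel-ternary : ∀ f n → ∃[ δ ] asTernary-fuel f n ≡ ternary δ
asTernary-fuel-ternary zero n = [] , refl
asTernary-fuel-ternary (suc f) n with asTernary-fuel-ternary f (n / 2) | <2⇒bit (m%n<n n 2)
... | δ , eq | e , eₑ = e ∷ δ , cong₂ (λ u v → u + 3 * v) (sym eₑ) eq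

asTernary-ternary : ∀ m → ∃[ δ ] asTernary m ≡ ternary δ
asTernary-ternary m = asTernary-fuel-ternary m m

ternary-asTernary : ∀ δ → ∃[ m ] asTernary m ≡ ternary δ
ternary-asTernary [] = 0 , refl
ternary-asTernary (e ∷ δ) with ternary-asTernary δ
... | m , eq = bit e + m * 2 ,
  trans (asTernary-digit (bit e) m (bit<2 e)) (cong (λ v → bit e + 3 * v) eq)

asTernary-<-suc : ∀ m → asTernary m < asTernary (suc m)
asTernary-<-suc = <-rec (λ m → asTernary m < asTernary (suc m)) step
  where
  less : ∀ a b → a < b → 1 + 3 * a < 0 + 3 * b
  less a b a<b = ≤-trans (≤-trans (n≤1+n _) (≤-reflexive (sym (*-suc 3 a)))) (*-monoʳ-≤ 3 a<b)
  step : ∀ m → (∀ {m′} → m′ < m → asTernary m′ < asTernary (suc m′)) → asTernary m < asTernary (suc m)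
  step m rec with parityView m
  ... | 0 , m′ , _ , refl =
    subst₂ _<_ (sym (asTernary-digit 0 m′ (s≤s z≤n))) (sym (asTernary-digit 1 m′ (s≤s (s≤s z≤n))))
           (n<1+n (3 * asTernary m′))
  ... | 1 , m′ , _ , refl =
    subst₂ _<_ (sym (asTernary-digit 1 m′ (s≤s (s≤s z≤n)))) (sym (asTernary-digit 0 (suc m′) (s≤s z≤n)))
           (less _ _ (rec (s≤s (m≤m*n m′ 2))))
  ... | suc (suc _) , _ , s≤s (s≤s ()) , _

asTernary-2^j+ : ∀ j m → m < 2 ^ j → asTernary (2 ^ j + m) ≡ 3 ^ j + asTernary m
asTernary-2^j+ zero zero _ = refl
asTernary-2^j+ zero (suc m) (s≤s ())
asTernary-2^j+ (suc j) m m<2^j with parityView m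
... | d , m′ , d<2 , refl =
  begin
    asTernary (2 ^ suc j + (d + m′ * 2)) ≡⟨ cong asTernary (shift (2 ^ j) d m′) ⟩
    asTernary (d + (2 ^ j + m′) * 2)     ≡⟨ asTernary-digit d (2 ^ j + m′) d<2 ⟩
    d + 3 * asTernary (2 ^ j + m′)       ≡⟨ cong (λ v → d + 3 * v) (asTernary-2^j+ j m′ m′<2^j) ⟩
    d + 3 * (3 ^ j + asTernary m′)       ≡⟨ distribute (3 ^ j) d (asTernary m′) ⟩
    3 ^ suc j + (d + 3 * asTernary m′)   ≡⟨ cong (3 ^ suc j +_) (sym (asTernary-digit d m′ d<2)) ⟩
    3 ^ suc j + asTernary (d + m′ * 2)   ∎
  where
  open ≡-Reasoning
  shift : ∀ p d m′ → 2 * p + (d + m′ * 2) ≡ d + (p + m′) * 2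
  shift = solve-∀
  distribute : ∀ p d t → d + 3 * (p + t) ≡ 3 * p + (d + 3 * t)
  distribute = solve-∀
  m′<2^j : m′ < 2 ^ j
  m′<2^j = *-cancelʳ-< _ m′ (2 ^ j)
             (≤-trans (s≤s (m≤n+m (m′ * 2) d)) (≤-trans m<2^j (≤-reflexive (*-comm 2 (2 ^ j)))))

asTernary-2^j-1 : ∀ j → ∃[ J ] (suc J ≡ 2 ^ j) × (2 * asTernary J + 1 ≡ 3 ^ j)
asTernary-2^j-1 zero = 0 , refl , refl
asTernary-2^j-1 (suc j) with asTernary-2^j-1 j
... | J , 1+J≡2^j , eq =
  1 + J * 2 ,
  trans (double+1 J) (cong (2 *_) 1+J≡2^j) ,
  trans (cong (λ v → 2 * v + 1) (asTernary-digit 1 J (s≤s (s≤s z≤n))))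
        (trans (triple (asTernary J)) (cong (3 *_) eq))
  where
  double+1 : ∀ J → suc (1 + J * 2) ≡ 2 * suc J
  double+1 = solve-∀
  triple : ∀ t → 2 * (1 + 3 * t) + 1 ≡ 3 * (2 * t + 1)
  triple = solve-∀

nth : List ℕ → ℕ → ℕ
nth [] _ = 0
nth (x ∷ xs) zero = x
nth (x ∷ xs) (suc i) = nth xs i

nth-∈ : ∀ xs {i} → i < length xs → nth xs i ∈ xs
nth-∈ (x ∷ xs) {zero} _ = here refl
nth-∈ (x ∷ xs) {suc i} (s≤s i<n) = there (nth-∈ xs i<n)

∈⇒nth : ∀ {x} xs → x ∈ xs → ∃[ i ] i < length xs × nth xs i ≡ x
∈⇒nth (y ∷ xs) (here refl) = 0 , s≤s z≤n , refl
∈⇒nth (y ∷ xs) (there x∈xs) with ∈⇒nth xs x∈xs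
... | i , i<n , eq = suc i , s≤s i<n , eq

nth-< : ∀ {xs} → AllPairs _<_ xs → ∀ {i j} → i < j → j < length xs → nth xs i < nth xs j
nth-< {x ∷ xs} (x<xs ∷ _) {zero} {suc j} _ (s≤s j<n) = All.lookup x<xs (nth-∈ xs j<n)
nth-< {x ∷ xs} (_ ∷ xs↗) {suc i} {suc j} (s≤s i<j) (s≤s j<n) = nth-< xs↗ i<j j<n

subsetSumFrom-∷ : ∀ b j e δ → subsetSumFrom b j (e ∷ δ) ≡ bit e * b j + subsetSumFrom b (suc j) δ
subsetSumFrom-∷ b j true δ = cong (_+ subsetSumFrom b (suc j) δ) (sym (+-identityʳ (b j)))
subsetSumFrom-∷ b j false δ = refl

subsetSumFrom-headBit : ∀ b j δ →
  subsetSumFrom b j δ ≡ bit (headBit δ) * b j + subsetSumFrom b (suc j) (tailBits δ)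
subsetSumFrom-headBit b j [] = refl
subsetSumFrom-headBit b j (e ∷ δ) = subsetSumFrom-∷ b j e δ

subsetSumFrom-++ : ∀ b j δ₁ δ₂ →
  subsetSumFrom b j (δ₁ ++ δ₂) ≡ subsetSumFrom b j δ₁ + subsetSumFrom b (j + length δ₁) δ₂
subsetSumFrom-++ b j [] δ₂ = cong (λ i → subsetSumFrom b i δ₂) (sym (+-identityʳ j))
subsetSumFrom-++ b j (e ∷ δ₁) δ₂ = begin
  subsetSumFrom b j (e ∷ δ₁ ++ δ₂)
    ≡⟨ subsetSumFrom-∷ b j e (δ₁ ++ δ₂) ⟩
  bit e * b j + subsetSumFrom b (suc j) (δ₁ ++ δ₂)
    ≡⟨ cong (bit e * b j +_) (subsetSumFrom-++ b (suc j) δ₁ δ₂) ⟩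
  bit e * b j + (subsetSumFrom b (suc j) δ₁ + subsetSumFrom b (suc j + length δ₁) δ₂)
    ≡⟨ sym (+-assoc (bit e * b j) _ _) ⟩
  bit e * b j + subsetSumFrom b (suc j) δ₁ + subsetSumFrom b (suc j + length δ₁) δ₂
    ≡⟨ cong₂ _+_ (sym (subsetSumFrom-∷ b j e δ₁)) (cong (λ i → subsetSumFrom b i δ₂) (sym (+-suc j (length δ₁)))) ⟩
  subsetSumFrom b j (e ∷ δ₁) + subsetSumFrom b (j + length (e ∷ δ₁)) δ₂
    ∎
  where open ≡-Reasoning

-- Unlike splitAt, the first part is padded with false to have length exactly n.
subsetSumFrom-split : ∀ b n j δ → ∃[ δ₁ ] ∃[ δ₂ ] (length δ₁ ≡ n) ×
  (subsetSumFrom b j δ ≡ subsetSumFrom b j δ₁ + subsetSumFrom b (j + n) δ₂)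
subsetSumFrom-split b zero j δ = [] , δ , refl , cong (λ i → subsetSumFrom b i δ) (sym (+-identityʳ j))
subsetSumFrom-split b (suc n) j δ with subsetSumFrom-split b n (suc j) (tailBits δ)
... | δ₁ , δ₂ , refl , eq = headBit δ ∷ δ₁ , δ₂ , refl , (begin
  subsetSumFrom b j δ
    ≡⟨ subsetSumFrom-headBit b j δ ⟩
  bit (headBit δ) * b j + subsetSumFrom b (suc j) (tailBits δ)
    ≡⟨ cong (bit (headBit δ) * b j +_) eq ⟩
  bit (headBit δ) * b j + (subsetSumFrom b (suc j) δ₁ + subsetSumFrom b (suc j + length δ₁) δ₂)
    ≡⟨ sym (+-assoc (bit (headBit δ) * b j) _ _) ⟩
  bit (headBit δ) * b j + subsetSumFrom b (suc j) δ₁ + subsetSumFrom b (suc j + length δ₁) δ₂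
    ≡⟨ cong₂ _+_ (sym (subsetSumFrom-∷ b j (headBit δ) δ₁))
                 (cong (λ i → subsetSumFrom b i δ₂) (sym (+-suc j (length δ₁)))) ⟩
  subsetSumFrom b j (headBit δ ∷ δ₁) + subsetSumFrom b (j + suc (length δ₁)) δ₂
    ∎)
  where open ≡-Reasoning

extend : ℕ → List ℕ → List ℕ
extend v T = T ++ map (v +_) T

∈-extend⁻ : ∀ {v x} T → x ∈ extend v T → ∃[ x₀ ] ∃[ e ] x₀ ∈ T × x ≡ x₀ + bit e * v
∈-extend⁻ {v} {x} T x∈ with ∈-++⁻ T x∈
... | inj₁ x∈T = x , false , x∈T , sym (+-identityʳ x)
... | inj₂ x∈v+T with ∈-map⁻ (v +_) x∈v+T
...   | x₀ , x₀∈T , refl = x₀ , true , x₀∈T , trans (+-comm v x₀) (cong (x₀ +_) (sym (+-identityʳ v)))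

∈-extend⁺ : ∀ {v x₀} T e → x₀ ∈ T → x₀ + bit e * v ∈ extend v T
∈-extend⁺ {v} {x₀} T false x₀∈T = subst (_∈ extend v T) (sym (+-identityʳ x₀)) (∈-++⁺ˡ x₀∈T)
∈-extend⁺ {v} {x₀} T true x₀∈T =
  subst (_∈ extend v T) (trans (+-comm v x₀) (cong (x₀ +_) (sym (+-identityʳ v))))
        (∈-++⁺ʳ T (∈-map⁺ (v +_) x₀∈T))

APFreeMod : ℕ → List ℕ → Set
APFreeMod N T = ∀ {x y z} → x ∈ T → y ∈ T → z ∈ T → x + z ≡ 2 * y [mod N ] → x ≡ y × y ≡ z

CoversMod : ℕ → List ℕ → Set
CoversMod N T = ∀ c → ∃[ y ] ∃[ z ] y ∈ T × z ∈ T × z ≤ y × c + z ≡ 2 * y [mod N ]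

NearModular⇒APFreeMod : ∀ {N A} → NearModular N A → APFreeMod N A
NearModular⇒APFreeMod {N} (_ , apFree , _) {x} {y} {z} x∈ y∈ z∈ x+z≡2y =
  apFree x y z x∈ y∈ z∈ (subst (λ w → N ∣ ∣ w ∣) (sym (pos-x-[2y-z] x y z)) (≡[mod]⇒∣⊖∣ (x + z) (2 * y) x+z≡2y))

NearModular⇒CoversMod : ∀ {N A} → NearModular N A → CoversMod N A
NearModular⇒CoversMod {N} (_ , _ , covers) c with covers (pos c)
... | y , z , y∈ , z∈ , z≤y , c≡2y-z =
  y , z , y∈ , z∈ , z≤y , ∣⊖∣⇒≡[mod] (c + z) (2 * y) (subst (λ w → N ∣ ∣ w ∣) (pos-x-[2y-z] c y z) c≡2y-z)

%3≢0 : ∀ u → u % 3 ≢ 0 → u % 3 ≡ 1 ⊎ u % 3 ≡ 2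
%3≢0 u u%3≢0 with u % 3 | m%n<n u 3
... | 0 | _ = ⊥-elim (u%3≢0 refl)
... | 1 | _ = inj₁ refl
... | 2 | _ = inj₂ refl
... | suc (suc (suc _)) | s≤s (s≤s (s≤s ()))

bits-3AP-mod3 : ∀ ex ey ez r → r ≡ 1 ⊎ r ≡ 2 → ((bit ex + bit ez) * r) % 3 ≡ (2 * bit ey * r) % 3 →
                ex ≡ ey × ey ≡ ez
bits-3AP-mod3 true true true _ _ _ = refl , refl
bits-3AP-mod3 false false false _ _ _ = refl , refl
bits-3AP-mod3 false false true .1 (inj₁ refl) ()
bits-3AP-mod3 false false true .2 (inj₂ refl) ()
bits-3AP-mod3 false true false .1 (inj₁ refl) ()
bits-3AP-mod3 false true false .2 (inj₂ refl) ()
bits-3AP-mod3 false true true .1 (inj₁ refl) ()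
bits-3AP-mod3 false true true .2 (inj₂ refl) ()
bits-3AP-mod3 true false false .1 (inj₁ refl) ()
bits-3AP-mod3 true false false .2 (inj₂ refl) ()
bits-3AP-mod3 true false true .1 (inj₁ refl) ()
bits-3AP-mod3 true false true .2 (inj₂ refl) ()
bits-3AP-mod3 true true false .1 (inj₁ refl) ()
bits-3AP-mod3 true true false .2 (inj₂ refl) ()

bits-solve-mod3 : ∀ q p r → q < 3 → p < 3 → r ≡ 1 ⊎ r ≡ 2 →
  ∃[ ey ] ∃[ ez ] bit ez ≤ bit ey × (q + bit ez * r) % 3 ≡ (p + 2 * bit ey * r) % 3
bits-solve-mod3 0 0 .1 _ _ (inj₁ refl) = false , false , z≤n , refl
bits-solve-mod3 0 0 .2 _ _ (inj₂ refl) = false , false , z≤n , refl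
bits-solve-mod3 0 1 .1 _ _ (inj₁ refl) = true , false , z≤n , refl
bits-solve-mod3 0 1 .2 _ _ (inj₂ refl) = true , true , s≤s z≤n , refl
bits-solve-mod3 0 2 .1 _ _ (inj₁ refl) = true , true , s≤s z≤n , refl
bits-solve-mod3 0 2 .2 _ _ (inj₂ refl) = true , false , z≤n , refl
bits-solve-mod3 1 0 .1 _ _ (inj₁ refl) = true , true , s≤s z≤n , refl
bits-solve-mod3 1 0 .2 _ _ (inj₂ refl) = true , false , z≤n , refl
bits-solve-mod3 1 1 .1 _ _ (inj₁ refl) = false , false , z≤n , refl
bits-solve-mod3 1 1 .2 _ _ (inj₂ refl) = false , false , z≤n , refl
bits-solve-mod3 1 2 .1 _ _ (inj₁ refl) = true , false , z≤n , refl
bits-solve-mod3 1 2 .2 _ _ (inj₂ refl) = true , true , s≤s z≤n , refl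
bits-solve-mod3 2 0 .1 _ _ (inj₁ refl) = true , false , z≤n , refl
bits-solve-mod3 2 0 .2 _ _ (inj₂ refl) = true , true , s≤s z≤n , refl
bits-solve-mod3 2 1 .1 _ _ (inj₁ refl) = true , true , s≤s z≤n , refl
bits-solve-mod3 2 1 .2 _ _ (inj₂ refl) = true , false , z≤n , refl
bits-solve-mod3 2 2 .1 _ _ (inj₁ refl) = false , false , z≤n , refl
bits-solve-mod3 2 2 .2 _ _ (inj₂ refl) = false , false , z≤n , refl
bits-solve-mod3 (suc (suc (suc _))) _ _ (s≤s (s≤s (s≤s ()))) _ _
bits-solve-mod3 _ (suc (suc (suc _))) _ _ (s≤s (s≤s (s≤s ()))) _

APFreeMod-extend : ∀ {N u T} .{{_ : NonZero N}} → u % 3 ≢ 0 →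
                   APFreeMod N T → APFreeMod (3 * N) (extend (u * N) T)
APFreeMod-extend {N} {u} {T} u%3≢0 apFree x∈ y∈ z∈ (p , q , eq)
  with ∈-extend⁻ T x∈ | ∈-extend⁻ T y∈ | ∈-extend⁻ T z∈
... | x₀ , ex , x₀∈ , refl | y₀ , ey , y₀∈ , refl | z₀ , ez , z₀∈ , refl
  with apFree x₀∈ y₀∈ z₀∈ (bit ex * u + bit ez * u + p * 3 , 2 * bit ey * u + q * 3 ,
         trans (regroupˡ x₀ z₀ (bit ex) (bit ez) u N p) (trans eq (regroupʳ y₀ (bit ey) u N q)))
  where
  regroupˡ : ∀ x z a c u N p →
    x + z + (a * u + c * u + p * 3) * N ≡ x + a * (u * N) + (z + c * (u * N)) + p * (3 * N)
  regroupˡ = solve-∀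
  regroupʳ : ∀ y a u N q → 2 * (y + a * (u * N)) + q * (3 * N) ≡ 2 * y + (2 * a * u + q * 3) * N
  regroupʳ = solve-∀
... | refl , refl = cong shifted (proj₁ bits) , cong shifted (proj₂ bits)
  where
  shifted : Bool → ℕ
  shifted e = x₀ + bit e * (u * N)
  regroupˡ : ∀ x a c u N p →
    x + x + ((a + c) * u + p * 3) * N ≡ x + a * (u * N) + (x + c * (u * N)) + p * (3 * N)
  regroupˡ = solve-∀
  regroupʳ : ∀ x a u N q → 2 * (x + a * (u * N)) + q * (3 * N) ≡ x + x + (2 * a * u + q * 3) * N
  regroupʳ = solve-∀
  coefficients : (bit ex + bit ez) * u + p * 3 ≡ 2 * bit ey * u + q * 3
  coefficients = *-cancelʳ-≡ _ _ N (+-cancelˡ-≡ (x₀ + x₀) _ _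
    (trans (regroupˡ x₀ (bit ex) (bit ez) u N p) (trans eq (regroupʳ x₀ (bit ey) u N q))))
  bits : ex ≡ ey × ey ≡ ez
  bits = bits-3AP-mod3 ex ey ez (u % 3) (%3≢0 u u%3≢0)
    (trans (sym (%-*-reduceʳ (bit ex + bit ez) u 3))
      (trans (≡[mod]⇒%≡ 3 (p , q , coefficients)) (%-*-reduceʳ (2 * bit ey) u 3)))

CoversMod-extend : ∀ {N u T} .{{_ : NonZero N}} → u % 3 ≢ 0 →
                   CoversMod N T → CoversMod (3 * N) (extend (u * N) T)
CoversMod-extend {N} {u} {T} u%3≢0 covers c with covers c
... | y₀ , z₀ , y₀∈ , z₀∈ , z₀≤y₀ , p , q , eq
  with bits-solve-mod3 (q % 3) (p % 3) (u % 3) (m%n<n q 3) (m%n<n p 3) (%3≢0 u u%3≢0)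
... | ey , ez , ez≤ey , solves =
  y₀ + bit ey * (u * N) , z₀ + bit ez * (u * N) , ∈-extend⁺ T ey y₀∈ , ∈-extend⁺ T ez z₀∈ ,
  +-mono-≤ z₀≤y₀ (*-monoˡ-≤ (u * N) ez≤ey) ,
  P′ , Q′ ,
  +-cancelʳ-≡ (p * N) _ _ (begin
    c + (z₀ + bit ez * (u * N)) + P′ * (3 * N) + p * N
      ≡⟨ regroup₁ c z₀ (bit ez) u N p P′ ⟩
    c + z₀ + p * N + (bit ez * u + P′ * 3) * N
      ≡⟨ cong (_+ (bit ez * u + P′ * 3) * N) eq ⟩
    2 * y₀ + q * N + (bit ez * u + P′ * 3) * N
      ≡⟨ regroup₂ y₀ q N (bit ez) u P′ ⟩
    2 * y₀ + (q + bit ez * u + P′ * 3) * N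
      ≡⟨ cong (λ v → 2 * y₀ + v * N) lifted ⟩
    2 * y₀ + (p + 2 * bit ey * u + Q′ * 3) * N
      ≡⟨ regroup₃ y₀ p N (bit ey) u Q′ ⟩
    2 * (y₀ + bit ey * (u * N)) + Q′ * (3 * N) + p * N
      ∎)
  where
  open ≡-Reasoning
  P′ Q′ : ℕ
  P′ = (p + 2 * bit ey * u) / 3
  Q′ = (q + bit ez * u) / 3
  lifted : q + bit ez * u + P′ * 3 ≡ p + 2 * bit ey * u + Q′ * 3
  lifted = proj₂ (proj₂ (%≡⇒≡[mod] {q + bit ez * u} {p + 2 * bit ey * u} 3 (trans (%-+-*-reduceʳ q (bit ez) u 3)
             (trans solves (sym (%-+-*-reduceʳ p (2 * bit ey) u 3))))))
  regroup₁ : ∀ c z a u N p P → c + (z + a * (u * N)) + P * (3 * N) + p * N ≡ c + z + p * N + (a * u + P * 3) * N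
  regroup₁ = solve-∀
  regroup₂ : ∀ y q N a u P → 2 * y + q * N + (a * u + P * 3) * N ≡ 2 * y + (q + a * u + P * 3) * N
  regroup₂ = solve-∀
  regroup₃ : ∀ y p N a u Q → 2 * y + (p + 2 * a * u + Q * 3) * N ≡ 2 * (y + a * (u * N)) + Q * (3 * N) + p * N
  regroup₃ = solve-∀

2x+p≡2m+y⇒y≡2x-[2m+1-p]+1 : ∀ x m p y → 2 * x + p ≡ 2 * m + y →
  pos y ≡ pos 2 ℤ.* pos x ℤ.- ((pos 2 ℤ.* pos m ℤ.+ pos 1) ℤ.- pos p) ℤ.+ pos 1
2x+p≡2m+y⇒y≡2x-[2m+1-p]+1 x m p y eq = sym (begin
  pos 2 ℤ.* pos x ℤ.- ((pos 2 ℤ.* pos m ℤ.+ pos 1) ℤ.- pos p) ℤ.+ pos 1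
    ≡⟨ regroup (pos x) (pos m) (pos p) ⟩
  (pos 2 ℤ.* pos x ℤ.+ pos p) ℤ.- pos 2 ℤ.* pos m
    ≡⟨ cong₂ ℤ._-_ (trans (cong (ℤ._+ pos p) (sym (ℤ.pos-* 2 x))) (sym (ℤ.pos-+ (2 * x) p))) (sym (ℤ.pos-* 2 m)) ⟩
  pos (2 * x + p) ℤ.- pos (2 * m)
    ≡⟨ cong (λ u → pos u ℤ.- pos (2 * m)) eq ⟩
  pos (2 * m + y) ℤ.- pos (2 * m)
    ≡⟨ cong (ℤ._- pos (2 * m)) (ℤ.pos-+ (2 * m) y) ⟩
  (pos (2 * m) ℤ.+ pos y) ℤ.- pos (2 * m)
    ≡⟨ cancel (pos (2 * m)) (pos y) ⟩
  pos y ∎)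
  where
  open ≡-Reasoning
  regroup : ∀ (x m p : ℤ) → pos 2 ℤ.* x ℤ.- ((pos 2 ℤ.* m ℤ.+ pos 1) ℤ.- p) ℤ.+ pos 1 ≡ (pos 2 ℤ.* x ℤ.+ p) ℤ.- pos 2 ℤ.* m
  regroup = ℤ-Solver.solve-∀
  cancel : ∀ (a c : ℤ) → (a ℤ.+ c) ℤ.- a ≡ c
  cancel = ℤ-Solver.solve-∀

module Construction
  (ℓ : ℕ) (A : List ℕ) (A-unique : Unique A) (A-nearModular : NearModular (3 ^ ℓ) A)
  (|A|≡2^ℓ : length A ≡ 2 ^ ℓ)
  (b : ℕ → ℕ) (b>0 : ∀ k → 0 < b k) (b-exact : ∀ k → ExactPow3 (k + ℓ) (b k))
  (K₀ : ℕ) (b-standard : ∀ k → K₀ ≤ k → b k ≡ 3 ^ (k + ℓ))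
  where

  modulus : ℕ → ℕ
  modulus k = 3 ^ (k + ℓ)

  modulus≢0 : ∀ k → NonZero (modulus k)
  modulus≢0 k = m^n≢0 3 (k + ℓ)

  b-factor : ∀ k → ∃[ u ] b k ≡ u * modulus k × u % 3 ≢ 0
  b-factor k with b-exact k
  ... | divides u bₖ≡uN , 3N∤bₖ = u , bₖ≡uN , λ u%3≡0 → 3N∤bₖ (divides (u / 3) (begin
    b k                            ≡⟨ bₖ≡uN ⟩
    u * modulus k                  ≡⟨ cong (_* modulus k) (m≡m%n+[m/n]*n u 3) ⟩
    (u % 3 + u / 3 * 3) * modulus k ≡⟨ cong (λ r → (r + u / 3 * 3) * modulus k) u%3≡0 ⟩
    u / 3 * 3 * modulus k          ≡⟨ *-assoc (u / 3) 3 (modulus k) ⟩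
    u / 3 * modulus (suc k)        ∎))
    where open ≡-Reasoning

  level : ℕ → List ℕ
  level zero = A
  level (suc k) = extend (b k) (level k)

  level-APFree : ∀ k → APFreeMod (modulus k) (level k)
  level-APFree zero = NearModular⇒APFreeMod A-nearModular
  level-APFree (suc k) with b-factor k
  ... | u , bₖ≡uN , u%3≢0 =
    subst (λ v → APFreeMod (modulus (suc k)) (extend v (level k))) (sym bₖ≡uN)
          (APFreeMod-extend {modulus k} {u} {{modulus≢0 k}} u%3≢0 (level-APFree k))

  level-Covers : ∀ k → CoversMod (modulus k) (level k)
  level-Covers zero = NearModular⇒CoversMod A-nearModular
  level-Covers (suc k) with b-factor k
  ... | u , bₖ≡uN , u%3≢0 =
    subst (λ v → CoversMod (modulus (suc k)) (extend v (level k))) (sym bₖ≡uN)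
          (CoversMod-extend {modulus k} {u} {{modulus≢0 k}} u%3≢0 (level-Covers k))

  -- x and x + bₖ cannot both lie in level k: (x + bₖ) + x ≡ 2x modulo 3^{k+ℓ} would be a 3-AP.
  level-unique : ∀ k → Unique (level k)
  level-unique zero = A-unique
  level-unique (suc k) =
    Unique.++⁺ (level-unique k) (Unique.map⁺ (+-cancelˡ-≡ (b k) _ _) (level-unique k)) disjoint
    where
    disjoint : ∀ {v} → ¬ (v ∈ level k × v ∈ map (b k +_) (level k))
    disjoint (v∈ , v∈shifted) with ∈-map⁻ (b k +_) v∈shifted | b-factor k
    ... | x , x∈ , refl | u , bₖ≡uN , _ =
      <⇒≢ (b>0 k) (sym (+-cancelʳ-≡ x (b k) 0 (proj₁ (level-APFree k v∈ x∈ x∈ (0 , u , (begin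
        b k + x + x + 0 * modulus k ≡⟨ +-identityʳ (b k + x + x) ⟩
        b k + x + x                 ≡⟨ regroup (b k) x ⟩
        2 * x + b k                 ≡⟨ cong (2 * x +_) bₖ≡uN ⟩
        2 * x + u * modulus k       ∎))))))
      where
      open ≡-Reasoning
      regroup : ∀ c x → c + x + x ≡ 2 * x + c
      regroup = solve-∀

  level-length : ∀ k → length (level k) ≡ 2 ^ (k + ℓ)
  level-length zero = |A|≡2^ℓ
  level-length (suc k) = begin
    length (level k ++ map (b k +_) (level k))          ≡⟨ length-++ (level k) ⟩
    length (level k) + length (map (b k +_) (level k))  ≡⟨ cong (length (level k) +_) (length-map (b k +_) (level k)) ⟩
    length (level k) + length (level k)                 ≡⟨ cong (λ n → n + n) (level-length k) ⟩
    2 ^ (k + ℓ) + 2 ^ (k + ℓ)                           ≡⟨ cong (2 ^ (k + ℓ) +_) (sym (+-identityʳ _)) ⟩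
    2 ^ suc (k + ℓ)                                     ∎
    where open ≡-Reasoning

  level-⊇-A : ∀ k {x} → x ∈ A → x ∈ level k
  level-⊇-A zero x∈ = x∈
  level-⊇-A (suc k) x∈ = ∈-++⁺ˡ (level-⊇-A k x∈)

  ∈-level⁻ : ∀ k {x} → x ∈ level k → ∃[ a ] ∃[ δ ] a ∈ A × length δ ≡ k × x ≡ a + subsetSumFrom b 0 δ
  ∈-level⁻ zero {x} x∈ = x , [] , x∈ , refl , sym (+-identityʳ x)
  ∈-level⁻ (suc k) x∈ with ∈-extend⁻ (level k) x∈
  ... | x₀ , e , x₀∈ , refl with ∈-level⁻ k x₀∈
  ...   | a , δ , a∈ , refl , refl = a , δ ++ e ∷ [] , a∈ ,
          trans (length-++ δ) (+-comm (length δ) 1) ,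
          (begin
            a + subsetSumFrom b 0 δ + bit e * b (length δ)
              ≡⟨ +-assoc a _ _ ⟩
            a + (subsetSumFrom b 0 δ + bit e * b (length δ))
              ≡⟨ cong (λ v → a + (subsetSumFrom b 0 δ + v)) (subsetSumFrom-singleton e) ⟨
            a + (subsetSumFrom b 0 δ + subsetSumFrom b (length δ) (e ∷ []))
              ≡⟨ cong (a +_) (subsetSumFrom-++ b 0 δ (e ∷ [])) ⟨
            a + subsetSumFrom b 0 (δ ++ e ∷ [])
              ∎)
    where
    open ≡-Reasoning
    subsetSumFrom-singleton : ∀ {n} e → subsetSumFrom b n (e ∷ []) ≡ bit e * b n
    subsetSumFrom-singleton true = refl
    subsetSumFrom-singleton false = refl

  ∈-level⁺ : ∀ δ j {x} → x ∈ level j → x + subsetSumFrom b j δ ∈ level (j + length δ)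
  ∈-level⁺ [] j {x} x∈ rewrite +-identityʳ j | +-identityʳ x = x∈
  ∈-level⁺ (e ∷ δ) j {x} x∈
    rewrite +-suc j (length δ) | subsetSumFrom-∷ b j e δ | sym (+-assoc x (bit e * b j) (subsetSumFrom b (suc j) δ))
    = ∈-level⁺ δ (suc j) (∈-extend⁺ (level j) e x∈)

  subsetSumFrom-standard : ∀ δ j → K₀ ≤ j → subsetSumFrom b j δ ≡ modulus j * ternary δ
  subsetSumFrom-standard [] j _ = sym (*-zeroʳ (modulus j))
  subsetSumFrom-standard (e ∷ δ) j K₀≤j = begin
    subsetSumFrom b j (e ∷ δ)                       ≡⟨ subsetSumFrom-∷ b j e δ ⟩
    bit e * b j + subsetSumFrom b (suc j) δ         ≡⟨ cong₂ (λ x y → bit e * x + y) (b-standard j K₀≤j)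
                                                         (subsetSumFrom-standard δ (suc j) (m≤n⇒m≤1+n K₀≤j)) ⟩
    bit e * modulus j + 3 * modulus j * ternary δ   ≡⟨ factor (bit e) (modulus j) (ternary δ) ⟩
    modulus j * (bit e + 3 * ternary δ)             ∎
    where
    open ≡-Reasoning
    factor : ∀ e N t → e * N + 3 * N * t ≡ N * (e + 3 * t)
    factor = solve-∀

  levelBound : ℕ → ℕ
  levelBound zero = max 0 A
  levelBound (suc k) = levelBound k + b k

  level-bounded : ∀ k {x} → x ∈ level k → x ≤ levelBound k
  level-bounded zero x∈ = All.lookup (xs≤max 0 A) x∈
  level-bounded (suc k) x∈ with ∈-extend⁻ (level k) x∈
  ... | x₀ , e , x₀∈ , refl = +-mono-≤ (level-bounded k x₀∈) (bit*≤ e)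
    where
    bit*≤ : ∀ e → bit e * b k ≤ b k
    bit*≤ true = ≤-reflexive (+-identityʳ (b k))
    bit*≤ false = z≤n

  levelBound-standard : ∀ j → 2 * levelBound (K₀ + j) + modulus K₀ ≡ 2 * levelBound K₀ + modulus (K₀ + j)
  levelBound-standard zero rewrite +-identityʳ K₀ = refl
  levelBound-standard (suc j) rewrite +-suc K₀ j | b-standard (K₀ + j) (m≤m+n K₀ j) = begin
    2 * (levelBound (K₀ + j) + modulus (K₀ + j)) + modulus K₀
      ≡⟨ regroup (levelBound (K₀ + j)) (modulus (K₀ + j)) (modulus K₀) ⟩
    2 * levelBound (K₀ + j) + modulus K₀ + 2 * modulus (K₀ + j)
      ≡⟨ cong (_+ 2 * modulus (K₀ + j)) (levelBound-standard j) ⟩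
    2 * levelBound K₀ + modulus (K₀ + j) + 2 * modulus (K₀ + j)
      ≡⟨ triple (2 * levelBound K₀) (modulus (K₀ + j)) ⟩
    2 * levelBound K₀ + 3 * modulus (K₀ + j)
      ∎
    where
    open ≡-Reasoning
    regroup : ∀ B X C → 2 * (B + X) + C ≡ 2 * B + C + 2 * X
    regroup = solve-∀
    triple : ∀ B X → B + X + 2 * X ≡ B + 3 * X
    triple = solve-∀

  -- Past K₀ the bound grows by the modulus itself, so 2·levelBound K₀ further levels
  -- push the modulus beyond twice the bound.
  K : ℕ
  K = K₀ + 2 * levelBound K₀

  P Q : ℕ
  P = modulus K
  Q = 2 ^ (K + ℓ)

  instance
    P≢0 : NonZero P
    P≢0 = modulus≢0 K
    Q≢0 : NonZero Q
    Q≢0 = m^n≢0 2 (K + ℓ)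

  Q>0 : 0 < Q
  Q>0 = m^n>0 2 (K + ℓ)

  levelBound-K<P : levelBound K < P
  levelBound-K<P = *-cancelˡ-< 2 (levelBound K) P (begin-strict
    2 * levelBound K                          <⟨ s≤s (m≤m+n (2 * levelBound K) (modulus K₀)) ⟩
    suc (2 * levelBound K + modulus K₀)       ≡⟨ cong suc (levelBound-standard (2 * levelBound K₀)) ⟩
    suc (2 * levelBound K₀ + P)               ≤⟨ +-monoˡ-< P 2·levelBound-K₀<P ⟩
    P + P                                     ≡⟨ cong (P +_) (+-identityʳ P) ⟨
    2 * P                                     ∎)
    where
    open ≤-Reasoning
    2·levelBound-K₀<P : 2 * levelBound K₀ < P
    2·levelBound-K₀<P = ≤-trans (s≤s (m≤n+m (2 * levelBound K₀) K₀))
                          (≤-trans (n<m^n (s≤s (s≤s z≤n)) K) (^-monoʳ-≤ 3 (m≤m+n K ℓ)))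

  level-K<P : ∀ {x} → x ∈ level K → x < P
  level-K<P x∈ = ≤-<-trans (level-bounded K x∈) levelBound-K<P

  enumeration : List ℕ
  enumeration = sort (level K)

  enumeration-↭ : enumeration ↭ level K
  enumeration-↭ = sort-↭ (level K)

  enumeration-↗ : AllPairs _<_ enumeration
  enumeration-↗ = AllPairs.zipWith (uncurry ≤∧≢⇒<)
    ( Linked⇒AllPairs ≤-trans (sort-↗ (level K))
    , Permutation.Unique-resp-↭ (↭⇒↭ₛ′ isEquivalence (↭-sym enumeration-↭)) (level-unique K))

  enumeration-length : length enumeration ≡ Q
  enumeration-length = trans (↭-length enumeration-↭) (level-length K)

  t : ℕ → ℕ
  t = nth enumeration

  t-< : ∀ {i j} → i < j → j < Q → t i < t j
  t-< i<j j<Q = nth-< enumeration-↗ i<j (subst (_ <_) (sym enumeration-length) j<Q)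

  t-∈ : ∀ {i} → i < Q → t i ∈ level K
  t-∈ i<Q = ∈-resp-↭ enumeration-↭ (nth-∈ enumeration (subst (_ <_) (sym enumeration-length) i<Q))

  ∈⇒t : ∀ {x} → x ∈ level K → ∃[ i ] i < Q × t i ≡ x
  ∈⇒t x∈ with ∈⇒nth enumeration (∈-resp-↭ (↭-sym enumeration-↭) x∈)
  ... | i , i<n , eq = i , subst (i <_) enumeration-length i<n , eq

  t0≡0 : t 0 ≡ 0
  t0≡0 with ∈⇒t (level-⊇-A K (proj₁ A-nearModular))
  ... | zero , _ , eq = eq
  ... | suc i , i<Q , eq = ⊥-elim (<⇒≱ (t-< (s≤s z≤n) i<Q) (≤-trans (≤-reflexive eq) z≤n))

  opaque
    s : ℕ → ℕ
    s n = t (n % Q) + P * asTernary (n / Q)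

    s-block : ∀ {i} m → i < Q → s (i + m * Q) ≡ t i + P * asTernary m
    s-block m i<Q = cong₂ (λ a c → t a + P * asTernary c) ([m+kn]%n≡m m i<Q) ([m+kn]/n≡k m i<Q)

  BlockView : ℕ → Set
  BlockView n = ∃[ i ] ∃[ m ] i < Q × n ≡ i + m * Q

  blockView : ∀ n → BlockView n
  blockView n = n % Q , n / Q , m%n<n n Q , m≡m%n+[m/n]*n n Q

  s-0 : s 0 ≡ 0
  s-0 = trans (s-block 0 Q>0) (trans (cong (_+ P * 0) t0≡0) (*-zeroʳ P))

  s-2Q : s (2 * Q) ≡ P * 3
  s-2Q = trans (s-block 2 Q>0) (cong (_+ P * 3) t0≡0)

  s-<-suc : ∀ n → s n < s (suc n)
  s-<-suc n with blockView n
  ... | i , m , i<Q , refl with m≤n⇒m<n∨m≡n i<Q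
  ...   | inj₁ 1+i<Q = subst₂ _<_ (sym (s-block m i<Q)) (sym (s-block m 1+i<Q))
                         (+-monoˡ-< (P * asTernary m) (t-< ≤-refl 1+i<Q))
  ...   | inj₂ 1+i≡Q = begin-strict
    s (i + m * Q)                  ≡⟨ s-block m i<Q ⟩
    t i + P * asTernary m          <⟨ +-monoˡ-< (P * asTernary m) (level-K<P (t-∈ i<Q)) ⟩
    P + P * asTernary m            ≡⟨ *-suc P (asTernary m) ⟨
    P * suc (asTernary m)          ≤⟨ *-monoʳ-≤ P (asTernary-<-suc m) ⟩
    P * asTernary (suc m)          ≡⟨ cong (_+ P * asTernary (suc m)) t0≡0 ⟨
    t 0 + P * asTernary (suc m)    ≡⟨ s-block (suc m) Q>0 ⟨
    s (Q + m * Q)                  ≡⟨ cong (λ v → s (v + m * Q)) 1+i≡Q ⟨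
    s (suc i + m * Q)              ∎
    where open ≤-Reasoning

  s-< : ∀ {i j} → i < j → s i < s j
  s-< {i} {suc j} (s≤s i≤j) with m≤n⇒m<n∨m≡n i≤j
  ... | inj₁ i<j = <-trans (s-< i<j) (s-<-suc j)
  ... | inj₂ refl = s-<-suc i

  s-≤ : ∀ {i j} → i ≤ j → s i ≤ s j
  s-≤ i≤j with m≤n⇒m<n∨m≡n i≤j
  ... | inj₁ i<j = <⇒≤ (s-< i<j)
  ... | inj₂ refl = ≤-refl

  s-cancel-< : ∀ {i j} → s i < s j → i < j
  s-cancel-< {i} {j} sᵢ<sⱼ with <-cmp i j
  ... | tri< i<j _ _ = i<j
  ... | tri≈ _ refl _ = ⊥-elim (<-irrefl refl sᵢ<sⱼ)
  ... | tri> _ _ j<i = ⊥-elim (<-asym sᵢ<sⱼ (s-< j<i))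

  Term : ℕ → Set
  Term x = ∃[ n ] s n ≡ x

  term⁺ : ∀ {y} δ → y ∈ level K → Term (y + P * ternary δ)
  term⁺ δ y∈ with ∈⇒t y∈ | ternary-asTernary δ
  ... | i , i<Q , refl | m , eq = i + m * Q , trans (s-block m i<Q) (cong (λ v → t i + P * v) eq)

  term⁻ : ∀ n → ∃[ y ] ∃[ δ ] y ∈ level K × s n ≡ y + P * ternary δ
  term⁻ n with blockView n
  ... | i , m , i<Q , refl with asTernary-ternary m
  ...   | δ , eq = t i , δ , t-∈ i<Q , trans (s-block m i<Q) (cong (λ v → t i + P * v) eq)

  shifted-3free : ∀ {x y z} a β c → x ∈ level K → y ∈ level K → z ∈ level K →
    x + P * ternary a + (z + P * ternary c) ≡ 2 * (y + P * ternary β) → x + P * ternary a ≡ y + P * ternary β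
  shifted-3free {x} {y} {z} a β c x∈ y∈ z∈ eq
    with level-APFree K x∈ y∈ z∈ (ternary a + ternary c , 2 * ternary β ,
           trans (regroupˡ x z P (ternary a) (ternary c)) (trans eq (regroupʳ y P (ternary β))))
    where
    regroupˡ : ∀ x z P a c → x + z + (a + c) * P ≡ x + P * a + (z + P * c)
    regroupˡ = solve-∀
    regroupʳ : ∀ y P b → 2 * (y + P * b) ≡ 2 * y + 2 * b * P
    regroupʳ = solve-∀
  ... | refl , refl = cong (λ v → x + P * v) (ternary-3free a β c ternaries)
    where
    regroupˡ : ∀ x P a c → x + x + P * (a + c) ≡ x + P * a + (x + P * c)
    regroupˡ = solve-∀
    regroupʳ : ∀ x P b → 2 * (x + P * b) ≡ x + x + P * (2 * b)
    regroupʳ = solve-∀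
    ternaries : ternary a + ternary c ≡ 2 * ternary β
    ternaries = *-cancelˡ-≡ (ternary a + ternary c) (2 * ternary β) P
      (+-cancelˡ-≡ (x + x) _ _ (trans (regroupˡ x P (ternary a) (ternary c)) (trans eq (regroupʳ x P (ternary β)))))

  terms-3free : ThreeFree Term
  terms-3free _ _ _ (n₁ , refl) (n₂ , refl) (n₃ , refl) eq with term⁻ n₁ | term⁻ n₂ | term⁻ n₃
  ... | x , a , x∈ , eq₁ | y , β , y∈ , eq₂ | z , c , z∈ , eq₃ =
    trans eq₁ (trans (shifted-3free a β c x∈ y∈ z∈
      (subst₂ (λ u v → u + v ≡ 2 * (y + P * ternary β)) eq₁ eq₃ (subst (λ w → s n₁ + s n₃ ≡ 2 * w) eq₂ eq)))
      (sym eq₂))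

  ThreeFree-⊆ : ∀ {R S : ℕ → Set} → (∀ {x} → R x → S x) → ThreeFree S → ThreeFree R
  ThreeFree-⊆ R⊆S S-3free x y z rx ry rz = S-3free x y z (R⊆S rx) (R⊆S ry) (R⊆S rz)

  term⇒GenSet : ∀ {x} → Term x → GenSet A b x
  term⇒GenSet (n , refl) with term⁻ n
  ... | y , δ₂ , y∈ , eq with ∈-level⁻ K y∈
  ...   | a , δ₁ , a∈ , |δ₁|≡K , refl = a , δ₁ ++ δ₂ , a∈ , (begin
    s n                                                               ≡⟨ eq ⟩
    a + subsetSumFrom b 0 δ₁ + P * ternary δ₂                         ≡⟨ +-assoc a _ _ ⟩
    a + (subsetSumFrom b 0 δ₁ + P * ternary δ₂)                       ≡⟨ cong (λ v → a + (subsetSumFrom b 0 δ₁ + v))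
                                                                           (subsetSumFrom-standard δ₂ K (m≤m+n K₀ _)) ⟨
    a + (subsetSumFrom b 0 δ₁ + subsetSumFrom b K δ₂)                 ≡⟨ cong (λ k → a + (subsetSumFrom b 0 δ₁ + subsetSumFrom b k δ₂))
                                                                           |δ₁|≡K ⟨
    a + (subsetSumFrom b 0 δ₁ + subsetSumFrom b (length δ₁) δ₂)        ≡⟨ cong (a +_) (subsetSumFrom-++ b 0 δ₁ δ₂) ⟨
    a + subsetSumFrom b 0 (δ₁ ++ δ₂)                                  ∎)
    where open ≡-Reasoning

  GenSet⇒term : ∀ {x} → GenSet A b x → Term x
  GenSet⇒term (a , δ , a∈ , refl) with subsetSumFrom-split b K 0 δ
  ... | δ₁ , δ₂ , |δ₁|≡K , eq with term⁺ δ₂ (subst (λ k → a + subsetSumFrom b 0 δ₁ ∈ level k) |δ₁|≡K (∈-level⁺ δ₁ 0 a∈))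
  ...   | n , sₙ≡ = n , (begin
    s n                                                   ≡⟨ sₙ≡ ⟩
    a + subsetSumFrom b 0 δ₁ + P * ternary δ₂             ≡⟨ +-assoc a _ _ ⟩
    a + (subsetSumFrom b 0 δ₁ + P * ternary δ₂)           ≡⟨ cong (λ v → a + (subsetSumFrom b 0 δ₁ + v))
                                                               (subsetSumFrom-standard δ₂ K (m≤m+n K₀ _)) ⟨
    a + (subsetSumFrom b 0 δ₁ + subsetSumFrom b K δ₂)     ≡⟨ cong (a +_) eq ⟨
    a + subsetSumFrom b 0 δ                               ∎)
    where open ≡-Reasoning

  2y≤c+z : ∀ {y} c z → y ∈ level K → 2 * P ≤ c → 2 * y ≤ c + z
  2y≤c+z c z y∈ 2P≤c = ≤-trans (<⇒≤ (*-monoʳ-< 2 (level-K<P y∈))) (≤-trans 2P≤c (m≤m+n c z))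

  -- Covering mod P gives c + z ≡ 2y with y, z ∈ level K; the multiple of P by which they
  -- differ is absorbed by ternary-split.
  completes-3AP : ∀ c → 2 * P ≤ c → ∃[ S₁ ] ∃[ S₂ ] Term S₁ × Term S₂ × S₂ ≤ S₁ × c + S₂ ≡ 2 * S₁
  completes-3AP c 2P≤c with level-Covers K c
  ... | y , z , y∈ , z∈ , z≤y , c+z≡2y
    with ≡[mod]⇒∸-divisible (2y≤c+z c z y∈ 2P≤c) c+z≡2y
  ...   | divides D c+z∸2y≡DP with ternary-split D
  ...     | δ , δ′ , D+δ′≡2δ , δ′≤δ =
    y + P * ternary δ , z + P * ternary δ′ , term⁺ δ y∈ , term⁺ δ′ z∈ ,
    +-mono-≤ z≤y (*-monoʳ-≤ P δ′≤δ) , (begin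
      c + (z + P * ternary δ′)                ≡⟨ +-assoc c z _ ⟨
      c + z + P * ternary δ′                  ≡⟨ cong (_+ P * ternary δ′) (m+[n∸m]≡n (2y≤c+z c z y∈ 2P≤c)) ⟨
      2 * y + (c + z ∸ 2 * y) + P * ternary δ′ ≡⟨ cong (λ v → 2 * y + v + P * ternary δ′) c+z∸2y≡DP ⟩
      2 * y + D * P + P * ternary δ′          ≡⟨ factor (2 * y) D P (ternary δ′) ⟩
      2 * y + P * (D + ternary δ′)            ≡⟨ cong (λ v → 2 * y + P * v) D+δ′≡2δ ⟩
      2 * y + P * (2 * ternary δ)             ≡⟨ double y P (ternary δ) ⟩
      2 * (y + P * ternary δ)                 ∎)
    where
    open ≡-Reasoning
    factor : ∀ a d P x → a + d * P + P * x ≡ a + P * (d + x)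
    factor = solve-∀
    double : ∀ y P x → 2 * y + P * (2 * x) ≡ 2 * (y + P * x)
    double = solve-∀

  s-between : ∀ {j n c} → s j < c → c < s (suc j) → s n ≢ c
  s-between {j} {n} sⱼ<c c<sⱼ₊₁ refl = <-irrefl refl (≤-trans (s-cancel-< c<sⱼ₊₁) (s-cancel-< sⱼ<c))

  s-greedy : ∀ j → suc (2 * Q) ≤ suc j → ∀ c → s j < c → c < s (suc j) →
             ¬ ThreeFree (λ x → Prefix s j x ⊎ x ≡ c)
  s-greedy j 2Q≤j c sⱼ<c c<sⱼ₊₁ 3free = no-completion (completes-3AP c 2P≤c)
    where
    2P≤c : 2 * P ≤ c
    2P≤c = ≤-trans (≤-trans (≤-reflexive (*-comm 2 P)) (*-monoʳ-≤ P (s≤s (s≤s z≤n))))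
             (≤-trans (≤-reflexive (sym s-2Q)) (≤-trans (s-≤ (≤-pred 2Q≤j)) (<⇒≤ sⱼ<c)))
    no-completion : ¬ (∃[ S₁ ] ∃[ S₂ ] Term S₁ × Term S₂ × S₂ ≤ S₁ × c + S₂ ≡ 2 * S₁)
    no-completion (_ , _ , (n₁ , refl) , (n₂ , refl) , S₂≤S₁ , c+S₂≡2S₁) with m≤n⇒m<n∨m≡n S₂≤S₁
    ... | inj₂ S₂≡S₁ = s-between sⱼ<c c<sⱼ₊₁ (sym c≡S₁)
      where
      c≡S₁ : c ≡ s n₁
      c≡S₁ = +-cancelʳ-≡ (s n₁) c (s n₁)
               (trans (cong (c +_) (sym S₂≡S₁)) (trans c+S₂≡2S₁ (cong (s n₁ +_) (+-identityʳ (s n₁)))))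
    ... | inj₁ S₂<S₁ = <-irrefl (3free (s n₂) (s n₁) c (inj₁ (n₂ , n₂≤j , refl)) (inj₁ (n₁ , n₁≤j , refl))
                                  (inj₂ refl) (trans (+-comm (s n₂) c) c+S₂≡2S₁)) S₂<S₁
      where
      S₁<c : s n₁ < c
      S₁<c = +-cancelʳ-< (s n₁) (s n₁) c
               (subst (_< c + s n₁) (trans c+S₂≡2S₁ (cong (s n₁ +_) (+-identityʳ (s n₁)))) (+-monoʳ-< c S₂<S₁))
      n₁≤j : n₁ ≤ j
      n₁≤j = ≤-pred (s-cancel-< (<-trans S₁<c c<sⱼ₊₁))
      n₂≤j : n₂ ≤ j
      n₂≤j = ≤-pred (s-cancel-< (<-trans S₂<S₁ (<-trans S₁<c c<sⱼ₊₁)))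

  -- The initial segment is s 0, …, s (2Q), ending at 3P; past it every candidate exceeds 2P.
  s-stanley : IsStanleyFrom (suc (2 * Q)) s
  s-stanley = s≤s z≤n , s-0 , s-<-suc , ThreeFree-⊆ (λ (i , _ , eq) → i , eq) terms-3free ,
              λ j 2Q≤j → ThreeFree-⊆ (λ (i , _ , eq) → i , eq) terms-3free , s-greedy j 2Q≤j

  2^[K+ℓ+j]≡2^j*Q : ∀ j → 2 ^ (K + ℓ + j) ≡ 2 ^ j * Q
  2^[K+ℓ+j]≡2^j*Q j = trans (^-distribˡ-+-* 2 (K + ℓ) j) (*-comm Q (2 ^ j))

  s-2^[K+ℓ+j] : ∀ j → s (2 ^ (K + ℓ + j)) ≡ P * 3 ^ j
  s-2^[K+ℓ+j] j = begin
    s (2 ^ (K + ℓ + j))          ≡⟨ cong s (2^[K+ℓ+j]≡2^j*Q j) ⟩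
    s (0 + 2 ^ j * Q)            ≡⟨ s-block (2 ^ j) Q>0 ⟩
    t 0 + P * asTernary (2 ^ j)  ≡⟨ cong₂ (λ a v → a + P * v) t0≡0
                                      (trans (cong asTernary (sym (+-identityʳ (2 ^ j))))
                                        (trans (asTernary-2^j+ j 0 (m^n>0 2 j)) (+-identityʳ _))) ⟩
    P * 3 ^ j                    ∎
    where open ≡-Reasoning

  s-2^[K+ℓ+j]+ : ∀ j i → i < 2 ^ (K + ℓ + j) → s (2 ^ (K + ℓ + j) + i) ≡ s (2 ^ (K + ℓ + j)) + s i
  s-2^[K+ℓ+j]+ j i i<2^[K+ℓ+j] with blockView i
  ... | r , m , r<Q , refl = begin
    s (2 ^ (K + ℓ + j) + (r + m * Q))     ≡⟨ cong (λ v → s (v + (r + m * Q))) (2^[K+ℓ+j]≡2^j*Q j) ⟩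
    s (2 ^ j * Q + (r + m * Q))          ≡⟨ cong s (regroup (2 ^ j) Q r m) ⟩
    s (r + (2 ^ j + m) * Q)              ≡⟨ s-block (2 ^ j + m) r<Q ⟩
    t r + P * asTernary (2 ^ j + m)      ≡⟨ cong (λ v → t r + P * v) (asTernary-2^j+ j m m<2^j) ⟩
    t r + P * (3 ^ j + asTernary m)      ≡⟨ distribute (t r) P (3 ^ j) (asTernary m) ⟩
    P * 3 ^ j + (t r + P * asTernary m)  ≡⟨ cong₂ _+_ (sym (s-2^[K+ℓ+j] j)) (sym (s-block m r<Q)) ⟩
    s (2 ^ (K + ℓ + j)) + s (r + m * Q)  ∎
    where
    open ≡-Reasoning
    regroup : ∀ x Q r m → x * Q + (r + m * Q) ≡ r + (x + m) * Q
    regroup = solve-∀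
    distribute : ∀ a P x y → a + P * (x + y) ≡ P * x + (a + P * y)
    distribute = solve-∀
    m<2^j : m < 2 ^ j
    m<2^j = *-cancelʳ-< Q m (2 ^ j)
      (≤-trans (s≤s (m≤n+m (m * Q) r)) (≤-trans i<2^[K+ℓ+j] (≤-reflexive (2^[K+ℓ+j]≡2^j*Q j))))

  λ′ : ℤ
  λ′ = (pos 2 ℤ.* pos (t (Q ∸ 1)) ℤ.+ pos 1) ℤ.- pos P

  s-2^[K+ℓ+j]-recurrence : ∀ j →
    pos (s (2 ^ (K + ℓ + j))) ≡ pos 2 ℤ.* pos (s (2 ^ (K + ℓ + j) ∸ 1)) ℤ.- λ′ ℤ.+ pos 1
  s-2^[K+ℓ+j]-recurrence j with asTernary-2^j-1 j
  ... | J , 1+J≡2^j , 2J+1≡3^j =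
    subst (λ w → pos (s (2 ^ (K + ℓ + j))) ≡ pos 2 ℤ.* pos w ℤ.- λ′ ℤ.+ pos 1) (sym last-term)
          (2x+p≡2m+y⇒y≡2x-[2m+1-p]+1 (t (Q ∸ 1) + P * asTernary J) (t (Q ∸ 1)) P (s (2 ^ (K + ℓ + j))) (begin
      2 * (t (Q ∸ 1) + P * asTernary J) + P     ≡⟨ regroup (t (Q ∸ 1)) P (asTernary J) ⟩
      2 * t (Q ∸ 1) + P * (2 * asTernary J + 1) ≡⟨ cong (λ v → 2 * t (Q ∸ 1) + P * v) 2J+1≡3^j ⟩
      2 * t (Q ∸ 1) + P * 3 ^ j                 ≡⟨ cong (2 * t (Q ∸ 1) +_) (s-2^[K+ℓ+j] j) ⟨
      2 * t (Q ∸ 1) + s (2 ^ (K + ℓ + j))       ∎))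
    where
    open ≡-Reasoning
    regroup : ∀ M P x → 2 * (M + P * x) + P ≡ 2 * M + P * (2 * x + 1)
    regroup = solve-∀
    last-index : 2 ^ (K + ℓ + j) ∸ 1 ≡ (Q ∸ 1) + J * Q
    last-index = cong (_∸ 1) (trans (2^[K+ℓ+j]≡2^j*Q j)
                   (trans (cong (_* Q) (sym 1+J≡2^j)) (cong (_+ J * Q) (sym (suc-pred Q)))))
    last-term : s (2 ^ (K + ℓ + j) ∸ 1) ≡ t (Q ∸ 1) + P * asTernary J
    last-term = trans (cong s last-index) (s-block J (subst (Q ∸ 1 <_) (suc-pred Q) ≤-refl))

  s-independent : Independent s
  s-independent = λ′ , K + ℓ , λ k K+ℓ≤k → independent-at k K+ℓ≤k
    where
    independent-at : ∀ k → K + ℓ ≤ k →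
      (∀ i → i < 2 ^ k → s (2 ^ k + i) ≡ s (2 ^ k) + s i) ×
      (pos (s (2 ^ k)) ≡ pos 2 ℤ.* pos (s (2 ^ k ∸ 1)) ℤ.- λ′ ℤ.+ pos 1)
    independent-at k K+ℓ≤k with m≤n⇒∃[o]m+o≡n K+ℓ≤k
    ... | j , refl = s-2^[K+ℓ+j]+ j , s-2^[K+ℓ+j]-recurrence j

lemma2p2 : (ℓ : ℕ) → 1 ≤ ℓ → (A : List ℕ) → Unique A → NearModular (3 ^ ℓ) A → length A ≡ 2 ^ ℓ
    → (b : ℕ → ℕ) → (∀ k → 0 < b k) → (∀ k → ExactPow3 (k + ℓ) (b k))
    → (∃[ K ] (∀ k → K ≤ k → b k ≡ 3 ^ (k + ℓ)))
    → ∃[ s ] (StanleySequence s × Independent s × (∀ x → (GenSet A b x ⇔ (∃[ n ] s n ≡ x))))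
lemma2p2 ℓ _ A A-unique A-nearModular |A|≡2^ℓ b b>0 b-exact (K₀ , b-standard) =
  s , (suc (2 * Q) , s-stanley) , s-independent , λ _ → mk⇔ GenSet⇒term term⇒GenSet
  where open Construction ℓ A A-unique A-nearModular |A|≡2^ℓ b b>0 b-exact K₀ b-standard
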